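{- Let $U$ be a based scheme on $Y$ and $S$ a based scheme on $Z$, let $\tilde T\subseteq S$ be a closed subset, and let $i:U\to S$ be a based morphism of schemes such that $i\pi:U\to S/\!\!/\tilde T$ is an isomorphism ($\pi$ the natural morphism). Assume $|t(ui)|=1$ for every $u\in U$ and $t\in\tilde T$. For $u\in U$ let $\tilde T'_u=\{t\in\tilde T:t(ui)=\{ui\}\}$ and $\tilde T''_u=\{t\in\tilde T:(ui)t=\{ui\}\}$. Suppose $(y_1,y_2)\in u$. If $z_1\in(y_1i)\tilde T$, then $z_1(ui)\cap(y_2i)\tilde T=z_2\tilde T''_u$ for some $z_2\in(y_2i)\tilde T$. Moreover, if $z_1'\in z_1\tilde T'_u$, then $z_1'(ui)\cap(y_2i)\tilde T=z_1(ui)\cap(y_2i)\tilde T$.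
   Context: All schemes are association schemes on finite sets. For $z\in Z$, $s\in S$, $zs=\{z':(z,z')\in s\}$; for $P\subseteq S$, $zP=\bigcup_{s\in P}zs$. Complex product $pq=\{r:a_{pqr}>0\}$; closed: $\tilde T^*\tilde T\subseteq\tilde T$. $s^{\tilde T}=\{(z_1\tilde T,z_2\tilde T):(z_1',z_2')\in s$ for some $z_i'\in z_i\tilde T\}$, $S/\!\!/\tilde T=\{s^{\tilde T}\}$. A morphism $i$ from $U$ on $Y$ to $S$ on $Z$ is a map $y\mapsto yi$ sending pairs in a common element of $U$ to pairs in a common element of $S$; $ui$ is the element of $S$ containing the images of pairs of $u$. Isomorphisms are bijective on points and relations; based morphisms preserve basepoints. -}

module Defs where

open import Data.Nat using (ℕ; _<_)
open import Data.Fin using (Fin; _≟_)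
open import Data.Bool using (Bool; true; false; _∧_; if_then_else_)
open import Data.List using (List; map; allFin)
open import Data.Nat.ListAction using (sum)
open import Data.Product using (Σ; ∃; ∃-syntax; _×_; _,_)
open import Relation.Nullary.Decidable using (⌊_⌋)
open import Relation.Binary.PropositionalEquality using (_≡_)
open import Relation.Unary using (Pred; _∈_; _⊆_; _≐_; ｛_｝; Satisfiable)
open import Level using (0ℓ)

count : (n : ℕ) → (Fin n → Bool) → ℕ
count n f = sum (map (λ z → if f z then 1 else 0) (allFin n))

-- A based association scheme on the point set Fin n with relation set Fin m.
-- R x y is the (unique) element of S containing (x , y).
record Scheme (n m : ℕ) : Set where
  field
    R      : Fin n → Fin n → Fin m
    base   : Fin n
    one    : Fin m
    one-⇒  : ∀ x y → R x y ≡ one → x ≡ y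
    one-⇐  : ∀ x → R x x ≡ one
    R-surj : ∀ s → ∃[ x ] ∃[ y ] R x y ≡ s
    tr     : Fin m → Fin m
    R-tr   : ∀ x y → R y x ≡ tr (R x y)
    a      : Fin m → Fin m → Fin m → ℕ
    a-spec : ∀ p q r x y → R x y ≡ r →
             count n (λ z → ⌊ R x z ≟ p ⌋ ∧ ⌊ R z y ≟ q ⌋) ≡ a p q r

module _ {n m : ℕ} (S : Scheme n m) where
  open Scheme S

  cp : Fin m → Fin m → Pred (Fin m) 0ℓ
  cp p q r = 0 < a p q r

  nbr : Fin n → Fin m → Pred (Fin n) 0ℓ
  nbr z s z' = R z z' ≡ s

  nbrs : Fin n → Pred (Fin m) 0ℓ → Pred (Fin n) 0ℓ
  nbrs z P z' = ∃[ s ] (s ∈ P × R z z' ≡ s)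

  Closed : Pred (Fin m) 0ℓ → Set
  Closed T = Satisfiable T × (∀ p q → p ∈ T → q ∈ T → cp (tr p) q ⊆ T)

  -- (z₁T , z₂T) ∈ s^T
  InQRel : Pred (Fin m) 0ℓ → Fin m → Fin n → Fin n → Set
  InQRel T s z₁ z₂ = ∃[ z₁' ] ∃[ z₂' ] (z₁' ∈ nbrs z₁ T × z₂' ∈ nbrs z₂ T × R z₁' z₂' ≡ s)

  CosetEq : Pred (Fin m) 0ℓ → Fin n → Fin n → Set
  CosetEq T z₁ z₂ = nbrs z₁ T ≐ nbrs z₂ T

  -- equality s^T = s'^T of elements of S//T (as sets of pairs of cosets)
  QRelEq : Pred (Fin m) 0ℓ → Fin m → Fin m → Set
  QRelEq T s s' = (∀ z₁ z₂ → InQRel T s z₁ z₂ → InQRel T s' z₁ z₂)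
                × (∀ z₁ z₂ → InQRel T s' z₁ z₂ → InQRel T s z₁ z₂)

record Morphism {nY mU nZ mS : ℕ} (U : Scheme nY mU) (S : Scheme nZ mS) : Set where
  field
    pt     : Fin nY → Fin nZ
    rel    : Fin mU → Fin mS
    compat : ∀ y₁ y₂ → Scheme.R S (pt y₁) (pt y₂) ≡ rel (Scheme.R U y₁ y₂)

Based : {nY mU nZ mS : ℕ} {U : Scheme nY mU} {S : Scheme nZ mS} → Morphism U S → Set
Based {U = U} {S} i = Morphism.pt i (Scheme.base U) ≡ Scheme.base S

-- i π : U → S//T is an isomorphism: y ↦ (yi)T and u ↦ (ui)^T are bijections
-- onto the points { zT } and the relations { s^T } of S//T.
IsoToQuotient : {nY mU nZ mS : ℕ} {U : Scheme nY mU} (S : Scheme nZ mS) →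
                Pred (Fin mS) 0ℓ → Morphism U S → Set
IsoToQuotient {nY} {mU} {nZ} {mS} S T i =
    (∀ y₁ y₂ → CosetEq S T (pt y₁) (pt y₂) → y₁ ≡ y₂)
  × (∀ (z : Fin nZ) → ∃[ y ] CosetEq S T (pt y) z)
  × (∀ u u' → QRelEq S T (rel u) (rel u') → u ≡ u')
  × (∀ (s : Fin mS) → ∃[ u ] QRelEq S T (rel u) s)
  where open Morphism i

-- Write s = ui.  Since iπ is an isomorphism onto S//T̃, the quotient relations s^T̃
-- are told apart by a single pair of cosets, and every pair of cosets in s^T̃ lifts
-- to an s-pair at any prescribed starting point: (z₁ , (y₂i)T̃) lifts to an s-pair
-- (z₁ , z₂) with z₂ ∈ (y₂i)T̃.  A point z of that coset, with (z₂ , z) ∈ t, lies in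
-- z₁s exactly when s ∈ st, and the hypothesis |t*(u*i)| = 1 says that st contains at
-- most one relation, so this happens exactly when st = {s}, i.e. z ∈ z₂T̃''.  For the second
-- part, t ∈ T̃' gives z₁'s ⊆ z₁s, and since t*s is a singleton containing s the two
-- neighbourhoods coincide.
module Submission where

open import Defs
open import Data.Nat using (ℕ)
open import Data.Fin using (Fin)
open import Data.Product using (∃; ∃-syntax; _×_)
open import Relation.Binary.PropositionalEquality using (_≡_)
open import Relation.Unary using (Pred; _∈_; _∩_; _≐_; ｛_｝)
open import Level using (0ℓ)

open import Data.Nat using (_<_; z≤n; s≤s)
open import Data.Nat.Properties using (<-≤-trans; m≤n+m)
open import Data.Fin using (_≟_)
open import Data.Bool using (Bool; true; false; T; if_then_else_)
open import Data.List using (List; _∷_; map; allFin)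
open import Data.List.Relation.Unary.Any using (here; there)
import Data.List.Membership.Propositional as List
open import Data.List.Membership.Propositional.Properties using (∈-allFin)
open import Data.Nat.ListAction using (sum)
open import Data.Product using (_,_; proj₁; proj₂)
open import Data.Unit using (tt)
open import Data.Bool.Properties using (T-∧)
open import Function.Bundles using (Equivalence)
open import Relation.Nullary.Decidable using (⌊_⌋; toWitness; fromWitness)
open import Relation.Unary using (_⊆_)
open import Relation.Binary.PropositionalEquality
  using (refl; sym; trans; cong; subst; module ≡-Reasoning)

module _ {A : Set} (f : A → Bool) where

  indicatorSum : List A → ℕ
  indicatorSum xs = sum (map (λ z → if f z then 1 else 0) xs)

  indicatorSum>0⇒∃ : ∀ xs → 0 < indicatorSum xs → ∃[ z ] T (f z)
  indicatorSum>0⇒∃ (x ∷ xs) p with f x in fx≡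
  ... | true  = x , subst T (sym fx≡) tt
  ... | false = indicatorSum>0⇒∃ xs p

  ∈⇒indicatorSum>0 : ∀ {z xs} → z List.∈ xs → T (f z) → 0 < indicatorSum xs
  ∈⇒indicatorSum>0 {z} (here refl) fz with f z
  ... | true = s≤s z≤n
  ∈⇒indicatorSum>0 {xs = x ∷ _} (there z∈xs) fz =
    <-≤-trans (∈⇒indicatorSum>0 z∈xs fz) (m≤n+m _ (if f x then 1 else 0))

∩-congʳ : {A : Set} {P Q R : Pred A 0ℓ} → P ≐ Q → (P ∩ R) ≐ (Q ∩ R)
∩-congʳ (P⊆Q , Q⊆P) = (λ (p , r) → P⊆Q p , r) , (λ (q , r) → Q⊆P q , r)

module SchemeProperties {n m : ℕ} (S : Scheme n m) where
  open Scheme S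

  a>0⇒midpoint : ∀ {x y p q r} → R x y ≡ r → 0 < a p q r → ∃[ z ] (R x z ≡ p × R z y ≡ q)
  a>0⇒midpoint {x} {y} {p} {q} {r} xy≡r a>0 =
    let midpoints>0 = subst (0 <_) (sym (a-spec p q r x y xy≡r)) a>0
        z , z∈ = indicatorSum>0⇒∃ _ (allFin n) midpoints>0
        xz≡p? , zy≡q? = Equivalence.to (T-∧ {⌊ R x z ≟ p ⌋}) z∈
    in  z , toWitness {a? = R x z ≟ p} xz≡p? , toWitness {a? = R z y ≟ q} zy≡q?

  midpoint⇒a>0 : ∀ {x y z p q} → R x z ≡ p → R z y ≡ q → 0 < a p q (R x y)
  midpoint⇒a>0 {x} {y} {z} {p} {q} xz≡p zy≡q =
    subst (0 <_) (a-spec p q (R x y) x y refl)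
      (∈⇒indicatorSum>0 _ (∈-allFin z) (Equivalence.from (T-∧ {⌊ R x z ≟ p ⌋})
        (fromWitness {a? = R x z ≟ p} xz≡p , fromWitness {a? = R z y ≟ q} zy≡q)))

  midpoint-transport : ∀ {x y z x' y' p q} → R x y ≡ R x' y' → R x z ≡ p → R z y ≡ q →
                       ∃[ z' ] (R x' z' ≡ p × R z' y' ≡ q)
  midpoint-transport xy≡x'y' xz≡p zy≡q = a>0⇒midpoint (sym xy≡x'y') (midpoint⇒a>0 xz≡p zy≡q)

  R-swap-cong : ∀ {x y x' y'} → R x y ≡ R x' y' → R y x ≡ R y' x'
  R-swap-cong {x} {y} {x'} {y'} xy≡x'y' = begin
    R y x       ≡⟨ R-tr x y ⟩
    tr (R x y)  ≡⟨ cong tr xy≡x'y' ⟩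
    tr (R x' y') ≡⟨ R-tr x' y' ⟨
    R y' x'     ∎
    where open ≡-Reasoning

  tr-involutive : ∀ s → tr (tr s) ≡ s
  tr-involutive s with R-surj s
  ... | x , y , refl = begin
    tr (tr (R x y)) ≡⟨ cong tr (R-tr x y) ⟨
    tr (R y x)      ≡⟨ R-tr y x ⟨
    R x y           ∎
    where open ≡-Reasoning

  tr-injective : ∀ {s s'} → tr s ≡ tr s' → s ≡ s'
  tr-injective {s} {s'} trs≡trs' =
    trans (sym (tr-involutive s)) (trans (cong tr trs≡trs') (tr-involutive s'))

  ∃-successor : ∀ x r → ∃[ z ] R x z ≡ r
  ∃-successor x r with R-surj r
  ... | x₀ , y₀ , x₀y₀≡r =
    let 1∈r·r* = subst (λ v → 0 < a r (tr r) v) (one-⇐ x₀)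
                   (midpoint⇒a>0 x₀y₀≡r (trans (R-tr x₀ y₀) (cong tr x₀y₀≡r)))
        z , xz≡r , _ = a>0⇒midpoint (one-⇐ x) 1∈r·r*
    in  z , xz≡r

  cp-tr : ∀ {p q r} → r ∈ cp S p q → tr r ∈ cp S (tr q) (tr p)
  cp-tr {r = r} r∈pq with R-surj r
  ... | x , y , refl with a>0⇒midpoint refl r∈pq
  ... | z , refl , refl = subst (λ v → 0 < a (tr (R z y)) (tr (R x z)) v) (R-tr x y)
                            (midpoint⇒a>0 (R-tr z y) (R-tr x z))

  cp-rotate : ∀ {p q r} → r ∈ cp S p q → q ∈ cp S (tr p) r
  cp-rotate {r = r} r∈pq with R-surj r
  ... | x , y , refl with a>0⇒midpoint refl r∈pq
  ... | z , refl , refl = midpoint⇒a>0 (R-tr x z) refl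

  cp-unique : ∀ {s t r r'} → ∃[ s₀ ] (cp S (tr t) (tr s) ≐ ｛ s₀ ｝) →
              r ∈ cp S s t → r' ∈ cp S s t → r ≡ r'
  cp-unique (s₀ , t*s*≐s₀) r∈st r'∈st =
    tr-injective (trans (sym (proj₁ t*s*≐s₀ (cp-tr r∈st))) (proj₁ t*s*≐s₀ (cp-tr r'∈st)))

  nbr-invariant : ∀ {t s z z'} → cp S t s ≐ ｛ s ｝ → ∃[ s₀ ] (cp S (tr t) s ≐ ｛ s₀ ｝) →
                  R z z' ≡ t → nbr S z' s ≐ nbr S z s
  nbr-invariant {t} {s} {z} {z'} ts≐s (s₀ , t*s≐s₀) zz'≡t = z's⊆zs , zs⊆z's
    where
    z's⊆zs : nbr S z' s ⊆ nbr S z s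
    z's⊆zs z'x≡s = sym (proj₁ ts≐s (midpoint⇒a>0 zz'≡t z'x≡s))

    zs⊆z's : nbr S z s ⊆ nbr S z' s
    zs⊆z's zx≡s = trans (sym (proj₁ t*s≐s₀ (midpoint⇒a>0 (trans (R-tr z z') (cong tr zz'≡t)) zx≡s)))
                        (proj₁ t*s≐s₀ (cp-rotate (proj₂ ts≐s refl)))

module ClosedProperties {n m : ℕ} (S : Scheme n m) (T̃ : Pred (Fin m) 0ℓ) (T̃-closed : Closed S T̃) where
  open Scheme S
  open SchemeProperties S

  Stabʳ : Fin m → Pred (Fin m) 0ℓ
  Stabʳ s t = t ∈ T̃ × (cp S s t ≐ ｛ s ｝)

  one∈T̃ : one ∈ T̃
  one∈T̃ with proj₁ T̃-closed
  ... | t , t∈T̃ with R-surj t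
  ... | x , y , refl = proj₂ T̃-closed (R x y) (R x y) t∈T̃ t∈T̃
                         (subst (λ v → 0 < a (tr (R x y)) (R x y) v) (one-⇐ y) (midpoint⇒a>0 (R-tr x y) refl))

  tr∈T̃ : ∀ {t} → t ∈ T̃ → tr t ∈ T̃
  tr∈T̃ {t} t∈T̃ with R-surj t
  ... | x , y , refl = subst T̃ (R-tr x y)
                         (proj₂ T̃-closed (R x y) one t∈T̃ one∈T̃ (midpoint⇒a>0 (R-tr x y) (one-⇐ x)))

  T̃-cp-closed : ∀ {p q r} → p ∈ T̃ → q ∈ T̃ → r ∈ cp S p q → r ∈ T̃
  T̃-cp-closed {p} {q} p∈T̃ q∈T̃ r∈pq =
    proj₂ T̃-closed (tr p) q (tr∈T̃ p∈T̃) q∈T̃ (subst (λ v → _ ∈ cp S v q) (sym (tr-involutive p)) r∈pq)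

  _∼_ : Fin n → Fin n → Set
  x ∼ y = R x y ∈ T̃

  ∼-refl : ∀ x → x ∼ x
  ∼-refl x = subst T̃ (sym (one-⇐ x)) one∈T̃

  ∼-sym : ∀ {x y} → x ∼ y → y ∼ x
  ∼-sym {x} {y} x∼y = subst T̃ (sym (R-tr x y)) (tr∈T̃ x∼y)

  ∼-trans : ∀ {x y z} → x ∼ y → y ∼ z → x ∼ z
  ∼-trans x∼y y∼z = T̃-cp-closed x∼y y∼z (midpoint⇒a>0 refl refl)

  nbrs⇒∼ : ∀ {x y} → y ∈ nbrs S x T̃ → x ∼ y
  nbrs⇒∼ (_ , t∈T̃ , refl) = t∈T̃

  ∼⇒nbrs : ∀ {x y} → x ∼ y → y ∈ nbrs S x T̃
  ∼⇒nbrs x∼y = _ , x∼y , refl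

  InQRel-resp-∼ : ∀ {s x y x' y'} → x ∼ x' → y ∼ y' → InQRel S T̃ s x y → InQRel S T̃ s x' y'
  InQRel-resp-∼ x∼x' y∼y' (a' , b' , xa' , yb' , a'b'≡s) =
    a' , b' , ∼⇒nbrs (∼-trans (∼-sym x∼x') (nbrs⇒∼ xa')) ,
              ∼⇒nbrs (∼-trans (∼-sym y∼y') (nbrs⇒∼ yb')) , a'b'≡s

  InQRel-resp-R : ∀ {s x y x' y'} → R x y ≡ R x' y' → InQRel S T̃ s x y → InQRel S T̃ s x' y'
  InQRel-resp-R {x = x} {y} xy≡x'y' (a' , b' , xa' , yb' , a'b'≡s)
    with midpoint-transport {z = b'} xy≡x'y' refl refl
  ... | b'' , x'b''≡xb' , b''y'≡b'y with midpoint-transport {z = a'} (sym x'b''≡xb') refl a'b'≡s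
  ... | a'' , x'a''≡xa' , a''b''≡s =
    a'' , b'' , ∼⇒nbrs (subst T̃ (sym x'a''≡xa') (nbrs⇒∼ xa')) ,
                ∼⇒nbrs (subst T̃ (R-swap-cong (sym b''y'≡b'y)) (nbrs⇒∼ yb')) , a''b''≡s

  InQRel-overlap⇒⊆ : ∀ {s s' w z} → InQRel S T̃ s w z → InQRel S T̃ s' w z →
                     ∀ z₁ z₂ → InQRel S T̃ s' z₁ z₂ → InQRel S T̃ s z₁ z₂
  InQRel-overlap⇒⊆ wz∈s (c , d , wc , zd , cd≡s') _ _ (a' , b' , z₁a' , z₂b' , a'b'≡s') =
    InQRel-resp-∼ (∼-sym (nbrs⇒∼ z₁a')) (∼-sym (nbrs⇒∼ z₂b'))
      (InQRel-resp-R (trans cd≡s' (sym a'b'≡s'))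
        (InQRel-resp-∼ (nbrs⇒∼ wc) (nbrs⇒∼ zd) wz∈s))

  nbr∩coset≐nbrs-Stabʳ : ∀ {s w z₁ z₂} →
    (∀ {t r r'} → t ∈ T̃ → r ∈ cp S s t → r' ∈ cp S s t → r ≡ r') →
    R z₁ z₂ ≡ s → w ∼ z₂ → (nbr S z₁ s ∩ nbrs S w T̃) ≐ nbrs S z₂ (Stabʳ s)
  nbr∩coset≐nbrs-Stabʳ {s} {w} {z₁} {z₂} st-unique z₁z₂≡s w∼z₂ = ⊆Stabʳ , Stabʳ⊆
    where
    ⊆Stabʳ : nbr S z₁ s ∩ nbrs S w T̃ ⊆ nbrs S z₂ (Stabʳ s)
    ⊆Stabʳ {z} (z₁z≡s , wz) = R z₂ z , (z₂∼z , singleton) , refl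
      where
      z₂∼z : z₂ ∼ z
      z₂∼z = ∼-trans (∼-sym w∼z₂) (nbrs⇒∼ wz)
      s∈s·t : s ∈ cp S s (R z₂ z)
      s∈s·t = subst (λ v → 0 < a s (R z₂ z) v) z₁z≡s (midpoint⇒a>0 z₁z₂≡s refl)
      singleton : cp S s (R z₂ z) ≐ ｛ s ｝
      singleton = (λ r∈s·t → st-unique z₂∼z s∈s·t r∈s·t) , λ { refl → s∈s·t }

    Stabʳ⊆ : nbrs S z₂ (Stabʳ s) ⊆ nbr S z₁ s ∩ nbrs S w T̃
    Stabʳ⊆ {z} (t , (t∈T̃ , s·t≐s) , z₂z≡t) =
      sym (proj₁ s·t≐s (midpoint⇒a>0 z₁z₂≡s z₂z≡t)) ,
      ∼⇒nbrs (∼-trans w∼z₂ (subst T̃ (sym z₂z≡t) t∈T̃))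

module MorphismProperties {nY mU nZ mS : ℕ} {U : Scheme nY mU} {S : Scheme nZ mS} (i : Morphism U S) where
  open Morphism i
  private
    module U = Scheme U
    module S = Scheme S

  rel-tr : ∀ u → rel (U.tr u) ≡ S.tr (rel u)
  rel-tr u with U.R-surj u
  ... | y₁ , y₂ , refl = begin
    rel (U.tr (U.R y₁ y₂))       ≡⟨ cong rel (U.R-tr y₁ y₂) ⟨
    rel (U.R y₂ y₁)              ≡⟨ compat y₂ y₁ ⟨
    S.R (pt y₂) (pt y₁)          ≡⟨ S.R-tr (pt y₁) (pt y₂) ⟩
    S.tr (S.R (pt y₁) (pt y₂))   ≡⟨ cong S.tr (compat y₁ y₂) ⟩
    S.tr (rel (U.R y₁ y₂))       ∎
    where open ≡-Reasoning

module QuotientIsoProperties {nY mU nZ mS : ℕ} (U : Scheme nY mU) (S : Scheme nZ mS)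
    (T̃ : Pred (Fin mS) 0ℓ) (T̃-closed : Closed S T̃)
    (i : Morphism U S) (iπ-iso : IsoToQuotient S T̃ i)
    (|t·ui|≡1 : ∀ u t → t ∈ T̃ → ∃[ s ] (cp S t (Morphism.rel i u) ≐ ｛ s ｝)) where
  open Scheme S
  open SchemeProperties S
  open ClosedProperties S T̃ T̃-closed
  open Morphism i
  private
    module U = Scheme U

  InQRel-lift-from-image : ∀ {u y z} → InQRel S T̃ (rel u) (pt y) z →
                           ∃[ b ] (z ∼ b × R (pt y) b ≡ rel u)
  InQRel-lift-from-image {u} {y} {z} yz∈u with proj₁ (proj₂ iπ-iso) z
  ... | y' , y'T̃≐zT̃ = pt y' , z∼y' , trans (compat y y') (cong rel yy'≡u)
    where
    z∼y' : z ∼ pt y'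
    z∼y' = ∼-sym (nbrs⇒∼ (proj₂ y'T̃≐zT̃ (∼⇒nbrs (∼-refl z))))
    yz∈yy' : InQRel S T̃ (rel (U.R y y')) (pt y) z
    yz∈yy' = pt y , pt y' , ∼⇒nbrs (∼-refl (pt y)) , ∼⇒nbrs z∼y' , compat y y'
    yy'≡u : U.R y y' ≡ u
    yy'≡u = proj₁ (proj₂ (proj₂ iπ-iso)) (U.R y y') u
              (InQRel-overlap⇒⊆ yz∈u yz∈yy' , InQRel-overlap⇒⊆ yz∈yy' yz∈u)

  InQRel-lift : ∀ {u x y} → InQRel S T̃ (rel u) x y → ∃[ b ] (y ∼ b × R x b ≡ rel u)
  InQRel-lift {u} {x} {y} xy∈u with ∃-successor (pt U.base) (R x y)
  ... | z , wz≡xy with InQRel-lift-from-image (InQRel-resp-R (sym wz≡xy) xy∈u)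
  ... | b' , z∼b' , wb'≡u with midpoint-transport wz≡xy wb'≡u refl
  ... | b , xb≡u , by≡b'z = b , subst T̃ (R-swap-cong (sym by≡b'z)) z∼b' , xb≡u

  ui·t-unique : ∀ u {t r r'} → t ∈ T̃ → r ∈ cp S (rel u) t → r' ∈ cp S (rel u) t → r ≡ r'
  ui·t-unique u {t} t∈T̃ = cp-unique
    (subst (λ v → ∃[ s₀ ] (cp S (tr t) v ≐ ｛ s₀ ｝)) (MorphismProperties.rel-tr i u)
      (|t·ui|≡1 (U.tr u) (tr t) (tr∈T̃ t∈T̃)))

  InQRel-image-pair : ∀ {y₁ y₂ z₁} → z₁ ∈ nbrs S (pt y₁) T̃ → InQRel S T̃ (rel (U.R y₁ y₂)) z₁ (pt y₂)
  InQRel-image-pair {y₁} {y₂} z₁∈y₁T̃ =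
    pt y₁ , pt y₂ , ∼⇒nbrs (∼-sym (nbrs⇒∼ z₁∈y₁T̃)) , ∼⇒nbrs (∼-refl (pt y₂)) , compat y₁ y₂

  nbr∩coset≐coset : ∀ {y₁ y₂ z₁} → z₁ ∈ nbrs S (pt y₁) T̃ →
    ∃[ z₂ ] (z₂ ∈ nbrs S (pt y₂) T̃ ×
             (nbr S z₁ (rel (U.R y₁ y₂)) ∩ nbrs S (pt y₂) T̃) ≐ nbrs S z₂ (Stabʳ (rel (U.R y₁ y₂))))
  nbr∩coset≐coset {y₁} {y₂} z₁∈y₁T̃ =
    let z₂ , y₂∼z₂ , z₁z₂≡ui = InQRel-lift {U.R y₁ y₂} (InQRel-image-pair {y₂ = y₂} z₁∈y₁T̃)
    in  z₂ , ∼⇒nbrs y₂∼z₂ , nbr∩coset≐nbrs-Stabʳ (ui·t-unique (U.R y₁ y₂)) z₁z₂≡ui y₂∼z₂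

  nbr∩coset-invariant : ∀ u {z₁ z₁' t} w → t ∈ T̃ → cp S t (rel u) ≐ ｛ rel u ｝ → R z₁ z₁' ≡ t →
    (nbr S z₁' (rel u) ∩ nbrs S w T̃) ≐ (nbr S z₁ (rel u) ∩ nbrs S w T̃)
  nbr∩coset-invariant u {t = t} _ t∈T̃ t·ui≐ui z₁z₁'≡t =
    ∩-congʳ (nbr-invariant t·ui≐ui (|t·ui|≡1 u (tr t) (tr∈T̃ t∈T̃)) z₁z₁'≡t)

lemma7p8 : {nY mU nZ mS : ℕ} (U : Scheme nY mU) (S : Scheme nZ mS)
    (T : Pred (Fin mS) 0ℓ) → Closed S T →
    (i : Morphism U S) → Based i → IsoToQuotient S T i →
    (∀ (u : Fin mU) (t : Fin mS) → t ∈ T →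
      ∃[ s ] (cp S t (Morphism.rel i u) ≐ ｛ s ｝)) →
    (u : Fin mU) (y₁ y₂ : Fin nY) → Scheme.R U y₁ y₂ ≡ u →
    (z₁ : Fin nZ) → z₁ ∈ nbrs S (Morphism.pt i y₁) T →
      (∃[ z₂ ] (z₂ ∈ nbrs S (Morphism.pt i y₂) T
        × ((nbr S z₁ (Morphism.rel i u) ∩ nbrs S (Morphism.pt i y₂) T)
           ≐ nbrs S z₂ (λ t → t ∈ T × (cp S (Morphism.rel i u) t ≐ ｛ Morphism.rel i u ｝)))))
    × (∀ (z₁' : Fin nZ) →
        z₁' ∈ nbrs S z₁ (λ t → t ∈ T × (cp S t (Morphism.rel i u) ≐ ｛ Morphism.rel i u ｝)) →
        (nbr S z₁' (Morphism.rel i u) ∩ nbrs S (Morphism.pt i y₂) T)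
          ≐ (nbr S z₁ (Morphism.rel i u) ∩ nbrs S (Morphism.pt i y₂) T))
lemma7p8 U S T T-closed i _ iπ-iso |t·ui|≡1 u y₁ y₂ refl z₁ z₁∈y₁T =
  nbr∩coset≐coset z₁∈y₁T ,
  λ { _ (t , (t∈T , t·ui≐ui) , z₁z₁'≡t) →
        nbr∩coset-invariant (Scheme.R U y₁ y₂) (Morphism.pt i y₂) t∈T t·ui≐ui z₁z₁'≡t }
  where open QuotientIsoProperties U S T T-closed i iπ-iso |t·ui|≡1
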